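{- Let $G=(V,E)$ be a graph and $x\in\mathrm{PM}(G)$ with $x_e>0$ for all $e\in E$. Suppose $S_1,S_2$ are tight odd sets. Then exactly one of the following holds: (1) $S_1\cup S_2$ is a tight odd set and $\Lambda(S_1)+\Lambda(S_2)\subseteq\Lambda(S_1\cup S_2)$; (2) $S_1$ and $S_2-S_1$ are both tight odd sets and $\Lambda(S_1)+\Lambda(S_2)\subseteq\Lambda(S_1)+\Lambda(S_2-S_1)$.
   Context: $\mathrm{PM}(G)$ is the perfect matching polytope of $G$ (convex hull of indicator vectors of perfect matchings). $\delta(T)$ is the set of edges with exactly one endpoint in $T$, $x(F)=\sum_{e\in F}x_e$. A tight odd set is $T\subseteq V$ with $|T|$ odd and $x(\delta(T))=1$. For $S\subseteq V$, $\Lambda(S)=\mathrm{span}\{\mathbf{1}_{\delta(T)}: T\subseteq S\text{ a tight odd set}\}\subseteq\mathbb{R}^E$. -}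

module Defs where

open import Level using (Level; _⊔_) renaming (suc to lsuc)
open import Data.Nat as ℕ using (ℕ; zero; suc; _%_)
open import Data.Bool using (Bool; true; false; if_then_else_; _xor_; _∧_)
open import Data.Fin using (Fin)
open import Data.Fin.Subset as Sub using (Subset; _⊆_)
open import Data.Vec using (lookup)
open import Data.Product using (_×_; _,_; proj₁; proj₂; ∃; ∃-syntax; Σ-syntax)
open import Data.Sum using (_⊎_)
open import Relation.Nullary using (¬_)
open import Relation.Binary.PropositionalEquality using (_≡_; _≢_)
open import Relation.Binary.Structures using (IsTotalOrder)
open import Algebra.Bundles using (CommutativeRing)

-- Ordered fields (the stdlib has none).  The paper works over ℝ; we state
-- the result for an arbitrary ordered field, ℝ being an instance.

record OrderedField (c ℓ₁ ℓ₂ : Level) : Set (lsuc (c ⊔ ℓ₁ ⊔ ℓ₂)) where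
  field
    commutativeRing : CommutativeRing c ℓ₁
  open CommutativeRing commutativeRing public
  infix 4 _≤_ _<_
  field
    _≤_          : Carrier → Carrier → Set ℓ₂
    isTotalOrder : IsTotalOrder _≈_ _≤_
    +-monoˡ-≤    : ∀ {a b} d → a ≤ b → (a + d) ≤ (b + d)
    *-nonneg     : ∀ {a b} → 0# ≤ a → 0# ≤ b → 0# ≤ (a * b)
    inverse      : ∀ a → ¬ (a ≈ 0#) → ∃ λ b → (a * b) ≈ 1#
    nontrivial   : ¬ (1# ≈ 0#)

  _<_ : Carrier → Carrier → Set (ℓ₁ ⊔ ℓ₂)
  a < b = (a ≤ b) × ¬ (a ≈ b)

SameEnds : ∀ {n} → Fin n × Fin n → Fin n × Fin n → Set
SameEnds (a , b) (c , d) = (a ≡ c × b ≡ d) ⊎ (a ≡ d × b ≡ c)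

record Graph : Set where
  field
    n m      : ℕ
    ends     : Fin m → Fin n × Fin n
    loopless : ∀ e → proj₁ (ends e) ≢ proj₂ (ends e)
    simple   : ∀ e f → SameEnds (ends e) (ends f) → e ≡ f

sumFin : ∀ {a} {A : Set a} → A → (A → A → A) → ∀ k → (Fin k → A) → A
sumFin z _⊕_ zero    f = z
sumFin z _⊕_ (suc k) f = f Fin.zero ⊕ sumFin z _⊕_ k (λ i → f (Fin.suc i))

countFin : ∀ k → (Fin k → Bool) → ℕ
countFin k p = sumFin 0 ℕ._+_ k (λ i → if p i then 1 else 0)

module Theory {c ℓ₁ ℓ₂} (F : OrderedField c ℓ₁ ℓ₂) (G : Graph) where
  open OrderedField F
  open Graph G

  Vect : Set c
  Vect = Fin m → Carrier

  Σ[_] : ∀ k → (Fin k → Carrier) → Carrier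
  Σ[ k ] f = sumFin 0# _+_ k f


  inS : Subset n → Fin n → Bool
  inS T v = lookup T v

  isEndpoint : Fin n → Fin m → Bool
  isEndpoint v e = Data.Bool._∨_ (inS Sub.⁅ v ⁆ (proj₁ (ends e)))
                                 (inS Sub.⁅ v ⁆ (proj₂ (ends e)))
    where import Data.Bool

  inδ : Subset n → Fin m → Bool
  inδ T e = inS T (proj₁ (ends e)) xor inS T (proj₂ (ends e))

  𝟙 : (Fin m → Bool) → Vect
  𝟙 M e = if M e then 1# else 0#

  x⟨_⟩ : Vect → (Fin m → Bool) → Carrier
  x⟨ x ⟩ M = Σ[ m ] (λ e → if M e then x e else 0#)

  PerfectMatching : (Fin m → Bool) → Set
  PerfectMatching M = ∀ v → countFin m (λ e → M e ∧ isEndpoint v e) ≡ 1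

  InPM : Vect → Set (c ⊔ ℓ₁ ⊔ ℓ₂)
  InPM x = ∃[ k ] Σ[ Ms ∈ (Fin k → Fin m → Bool) ] Σ[ λs ∈ (Fin k → Carrier) ]
             (∀ i → PerfectMatching (Ms i)) ×
             (∀ i → 0# ≤ λs i) ×
             (Σ[ k ] λs ≈ 1#) ×
             (∀ e → x e ≈ Σ[ k ] (λ i → λs i * 𝟙 (Ms i) e))

  Odd : Subset n → Set
  Odd T = Sub.∣ T ∣ % 2 ≡ 1

  TightOdd : Vect → Subset n → Set ℓ₁
  TightOdd x T = Odd T × (x⟨ x ⟩ (inδ T) ≈ 1#)

  Λ : Vect → Subset n → Vect → Set (c ⊔ ℓ₁)
  Λ x S v = ∃[ k ] Σ[ Ts ∈ (Fin k → Subset n) ] Σ[ cs ∈ (Fin k → Carrier) ]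
              (∀ i → Ts i ⊆ S × TightOdd x (Ts i)) ×
              (∀ e → v e ≈ Σ[ k ] (λ i → cs i * 𝟙 (inδ (Ts i)) e))

  _⊕_ : ∀ {a b} → (Vect → Set a) → (Vect → Set b) → Vect → Set (c ⊔ ℓ₁ ⊔ a ⊔ b)
  (A ⊕ B) v = ∃[ u ] ∃[ w ] A u × B w × (∀ e → v e ≈ u e + w e)

  _⊑_ : ∀ {a b} → (Vect → Set a) → (Vect → Set b) → Set (c ⊔ a ⊔ b)
  A ⊑ B = ∀ v → A v → B v

module Submission where

open import Defs
open import Level using (Level; _⊔_)
open import Function using (_∘_)
open import Data.Nat as ℕ using (ℕ; zero; suc; _%_)
open import Data.Bool using (Bool; true; false; not; _∧_; _∨_; _xor_; if_then_else_)
open import Data.Bool.Properties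
  using ( xor-∧-commutativeRing; not-involutive; not-distribˡ-xor; ∧-zeroʳ; ∧-identityʳ
        ; xor-identityʳ; ∧-distribˡ-xor; ∧-assoc; ∧-comm)
open import Data.Fin using (Fin; splitAt) renaming (zero to fzero; suc to fsuc)
open import Data.Fin.Subset as Sub using (Subset; _∪_; _∩_; _─_; _⊆_; ⁅_⁆)
open import Data.Fin.Subset.Properties using (∩-comm; x∈⁅y⁆⇒x≡y; ⊆-refl; p─q⊆p; p∩q⊆q; p⊆p∪q; q⊆p∪q)
open import Data.Vec using ([]; _∷_; lookup)
open import Data.Vec.Properties using (lookup-zipWith; lookup-replicate; []=⇒lookup; lookup⇒[]=)
open import Data.Vec.Functional using (Vector; _++_)
open import Data.Vec.Functional.Relation.Unary.All.Properties using (++⁺)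
open import Data.Product using (_×_; _,_; proj₁; proj₂; ∃-syntax)
open import Data.Sum using (_⊎_; inj₁; inj₂)
open import Data.Sum.Properties using ([,]-map)
open import Relation.Nullary using (¬_)
open import Data.Empty using (⊥; ⊥-elim)
import Relation.Binary.PropositionalEquality as ≡
open ≡ using (_≡_)
open import Algebra.Bundles using (CommutativeSemiring; CommutativeRing)
open import Relation.Binary.Structures using (IsTotalOrder)
import Algebra.Properties.Ring as RingProperties

-- Parity bookkeeping: for odd S₁, S₂ the set S₁ ∪ S₂ is odd iff S₁ ∩ S₂ is odd,
-- and S₁ ─ S₂, S₂ ─ S₁ are odd iff S₁ ∩ S₂ is even; so exactly one of the two
-- pairs (S₁ ∩ S₂, S₁ ∪ S₂), (S₁ ─ S₂, S₂ ─ S₁) consists of odd sets.  Every point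
-- of PM(G) satisfies x(δ(U)) ≥ 1 for odd U, because a perfect matching meets every
-- odd cut (handshake modulo 2).  Counting edges gives 𝟙δA + 𝟙δB = 𝟙δC + 𝟙δD + 2·𝟙X
-- for both pairs, X being the edges joining two "diagonal" parts; for tight A, B
-- and odd C, D the odd-cut inequality then forces C, D tight and x(X) = 0, hence
-- X = ∅ as x > 0 (uncrossing).  Case 1 follows by monotonicity of Λ.  In case 2
-- each generator 𝟙δT of Λ(S₂) is rewritten, by one or two uncrossings with S₁
-- and S₂ ─ S₁, as a combination of cut vectors of tight odd subsets of S₁ and of
-- S₂ ─ S₁.

-- Finite sums  sumFin 0# _+_  in a commutative semiring, related to the
-- library's  sum  so that its algebraic laws can be reused.
module FinSum {c ℓ} (R : CommutativeSemiring c ℓ) where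
  open CommutativeSemiring R
  open import Algebra.Properties.Semiring.Sum semiring
    using (sum; sum-cong-≋; sum-replicate-zero; ∑-distrib-+; ∑-comm; *-distribˡ-sum)

  sumᶠ : ∀ k → (Fin k → Carrier) → Carrier
  sumᶠ = sumFin 0# _+_

  sumᶠ≡sum : ∀ k (f : Fin k → Carrier) → sumᶠ k f ≡ sum f
  sumᶠ≡sum zero    f = ≡.refl
  sumᶠ≡sum (suc k) f = ≡.cong (f fzero +_) (sumᶠ≡sum k (f ∘ fsuc))

  private
    fromSum : ∀ {k l} (f : Fin k → Carrier) (g : Fin l → Carrier) →
              sum f ≈ sum g → sumᶠ k f ≈ sumᶠ l g
    fromSum {k} {l} f g = ≡.subst₂ _≈_ (≡.sym (sumᶠ≡sum k f)) (≡.sym (sumᶠ≡sum l g))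

  sumᶠ-cong : ∀ k {f g : Fin k → Carrier} → (∀ i → f i ≈ g i) → sumᶠ k f ≈ sumᶠ k g
  sumᶠ-cong k {f} {g} f≈g = fromSum f g (sum-cong-≋ f≈g)

  sumᶠ-zero : ∀ k → sumᶠ k (λ _ → 0#) ≈ 0#
  sumᶠ-zero k = trans (reflexive (sumᶠ≡sum k _)) (sum-replicate-zero k)

  sumᶠ-+ : ∀ k (f g : Fin k → Carrier) → sumᶠ k (λ i → f i + g i) ≈ sumᶠ k f + sumᶠ k g
  sumᶠ-+ k f g = trans (reflexive (sumᶠ≡sum k _))
    (trans (∑-distrib-+ f g) (sym (reflexive (≡.cong₂ _+_ (sumᶠ≡sum k f) (sumᶠ≡sum k g)))))

  sumᶠ-comm : ∀ k l (f : Fin k → Fin l → Carrier) →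
              sumᶠ k (λ i → sumᶠ l (f i)) ≈ sumᶠ l (λ j → sumᶠ k (λ i → f i j))
  sumᶠ-comm k l f = begin
    sumᶠ k (λ i → sumᶠ l (f i))        ≈⟨ sumᶠ-cong k (λ i → reflexive (sumᶠ≡sum l (f i))) ⟩
    sumᶠ k (λ i → sum (f i))           ≈⟨ fromSum (λ i → sum (f i)) (λ j → sum (λ i → f i j)) (∑-comm f) ⟩
    sumᶠ l (λ j → sum (λ i → f i j))   ≈⟨ sumᶠ-cong l (λ j → reflexive (≡.sym (sumᶠ≡sum k _))) ⟩
    sumᶠ l (λ j → sumᶠ k (λ i → f i j)) ∎
    where open import Relation.Binary.Reasoning.Setoid setoid

  sumᶠ-*ˡ : ∀ k a (f : Fin k → Carrier) → sumᶠ k (λ i → a * f i) ≈ a * sumᶠ k f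
  sumᶠ-*ˡ k a f = trans (reflexive (sumᶠ≡sum k _))
    (trans (sym (*-distribˡ-sum a f)) (*-congˡ (reflexive (≡.sym (sumᶠ≡sum k f)))))

  sumᶠ-++ : ∀ k l (f : Fin k → Carrier) (g : Fin l → Carrier) →
            sumᶠ (k ℕ.+ l) (f ++ g) ≈ sumᶠ k f + sumᶠ l g
  sumᶠ-++ zero    l f g = sym (+-identityˡ _)
  sumᶠ-++ (suc k) l f g = trans
    (+-congˡ (trans (sumᶠ-cong (k ℕ.+ l) (λ i → reflexive ([,]-map (splitAt k i))))
                    (sumᶠ-++ k l (f ∘ fsuc) g)))
    (sym (+-assoc _ _ _))

module Parity where
  open ≡ using (refl; sym; trans; cong; cong₂)
  module ⊕ = FinSum (CommutativeRing.commutativeSemiring xor-∧-commutativeRing)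

  xorSum : ∀ k → (Fin k → Bool) → Bool
  xorSum = ⊕.sumᶠ

  bit : Bool → ℕ
  bit b = if b then 1 else 0

  odd : ℕ → Bool
  odd zero    = false
  odd (suc n) = not (odd n)

  odd-+ : ∀ a b → odd (a ℕ.+ b) ≡ odd a xor odd b
  odd-+ zero    b = refl
  odd-+ (suc a) b = trans (cong not (odd-+ a b)) (not-distribˡ-xor (odd a) (odd b))

  odd-bit : ∀ b → odd (bit b) ≡ b
  odd-bit true  = refl
  odd-bit false = refl

  odd-countFin : ∀ k (p : Fin k → Bool) → odd (countFin k p) ≡ xorSum k p
  odd-countFin zero    p = refl
  odd-countFin (suc k) p = trans (odd-+ (bit (p fzero)) _)
    (cong₂ _xor_ (odd-bit (p fzero)) (odd-countFin k (p ∘ fsuc)))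

  %2≡bit-odd : ∀ n → n % 2 ≡ bit (odd n)
  %2≡bit-odd zero          = refl
  %2≡bit-odd (suc zero)    = refl
  %2≡bit-odd (suc (suc n)) = trans (%2≡bit-odd n) (cong bit (sym (not-involutive (odd n))))

  parity : ∀ {n} → Subset n → Bool
  parity {n} p = xorSum n (lookup p)

  ∣∣≡countFin : ∀ {n} (p : Subset n) → Sub.∣ p ∣ ≡ countFin n (lookup p)
  ∣∣≡countFin []          = refl
  ∣∣≡countFin (true ∷ p)  = cong suc (∣∣≡countFin p)
  ∣∣≡countFin (false ∷ p) = ∣∣≡countFin p

  odd-∣∣ : ∀ {n} (p : Subset n) → odd Sub.∣ p ∣ ≡ parity p
  odd-∣∣ {n} p = trans (cong odd (∣∣≡countFin p)) (odd-countFin n (lookup p))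

  odd⇒parity : ∀ {n} (p : Subset n) → Sub.∣ p ∣ % 2 ≡ 1 → parity p ≡ true
  odd⇒parity p h = trans (sym (odd-∣∣ p)) (bit≡1 (trans (sym (%2≡bit-odd Sub.∣ p ∣)) h))
    where
    bit≡1 : ∀ {b} → bit b ≡ 1 → b ≡ true
    bit≡1 {true} _ = refl

  parity⇒odd : ∀ {n} (p : Subset n) → parity p ≡ true → Sub.∣ p ∣ % 2 ≡ 1
  parity⇒odd p h = trans (%2≡bit-odd Sub.∣ p ∣) (cong bit (trans (odd-∣∣ p) h))

  lookup-∩ : ∀ {n} (p q : Subset n) i → lookup (p ∩ q) i ≡ lookup p i ∧ lookup q i
  lookup-∩ p q i = lookup-zipWith _∧_ i p q

  lookup-∪ : ∀ {n} (p q : Subset n) i → lookup (p ∪ q) i ≡ lookup p i ∨ lookup q i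
  lookup-∪ p q i = lookup-zipWith _∨_ i p q

  lookup-─ : ∀ {n} (p q : Subset n) i → lookup (p ─ q) i ≡ lookup p i ∧ not (lookup q i)
  lookup-─ (a ∷ p)     (true ∷ q)  fzero    = sym (∧-zeroʳ a)
  lookup-─ (true ∷ p)  (false ∷ q) fzero    = refl
  lookup-─ (false ∷ p) (false ∷ q) fzero    = refl
  lookup-─ (a ∷ p)     (b ∷ q)     (fsuc i) = lookup-─ p q i

  parity-∪ : ∀ {n} (p q : Subset n) → parity (p ∪ q) ≡ (parity p xor parity q) xor parity (p ∩ q)
  parity-∪ {n} p q = trans
    (⊕.sumᶠ-cong n (λ i → trans (lookup-∪ p q i)
      (trans (∨≡xor (lookup p i) (lookup q i))
        (cong ((lookup p i xor lookup q i) xor_) (sym (lookup-∩ p q i))))))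
    (trans (⊕.sumᶠ-+ n _ _) (cong (_xor parity (p ∩ q)) (⊕.sumᶠ-+ n _ _)))
    where
    ∨≡xor : ∀ a b → a ∨ b ≡ (a xor b) xor (a ∧ b)
    ∨≡xor true  true  = refl
    ∨≡xor true  false = refl
    ∨≡xor false true  = refl
    ∨≡xor false false = refl

  parity-─ : ∀ {n} (p q : Subset n) → parity (p ─ q) ≡ parity p xor parity (p ∩ q)
  parity-─ {n} p q = trans
    (⊕.sumᶠ-cong n (λ i → trans (lookup-─ p q i)
      (trans (∧not≡xor (lookup p i) (lookup q i))
        (cong (lookup p i xor_) (sym (lookup-∩ p q i))))))
    (⊕.sumᶠ-+ n _ _)
    where
    ∧not≡xor : ∀ a b → a ∧ not b ≡ a xor (a ∧ b)
    ∧not≡xor true  true  = refl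
    ∧not≡xor true  false = refl
    ∧not≡xor false b     = refl

  odd-∪ : ∀ {n} (p q : Subset n) → parity p ≡ true → parity q ≡ true →
          parity (p ∪ q) ≡ parity (p ∩ q)
  odd-∪ p q odd-p odd-q = trans (parity-∪ p q) (cong₂ (λ a b → (a xor b) xor parity (p ∩ q)) odd-p odd-q)

  odd-─ : ∀ {n} (p q : Subset n) → parity p ≡ true → parity (p ─ q) ≡ not (parity (p ∩ q))
  odd-─ p q odd-p = trans (parity-─ p q) (cong (_xor parity (p ∩ q)) odd-p)

  odd-─′ : ∀ {n} (p q : Subset n) → parity q ≡ true → parity (q ─ p) ≡ not (parity (p ∩ q))
  odd-─′ p q odd-q = trans (odd-─ q p odd-q) (cong (not ∘ parity) (∩-comm q p))

  ∪-─-not-both-odd : ∀ {n} (p q : Subset n) → parity p ≡ true → parity q ≡ true →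
                     parity (p ∪ q) ≡ true → parity (q ─ p) ≡ true → ⊥
  ∪-─-not-both-odd p q odd-p odd-q odd-∪pq odd-q─p
    with trans (sym odd-q─p) (trans (odd-─′ p q odd-q) (cong not (trans (sym (odd-∪ p q odd-p odd-q)) odd-∪pq)))
  ... | ()

  xorSum-true : ∀ k (f : Fin k → Bool) → xorSum k f ≡ true → ∃[ i ] f i ≡ true
  xorSum-true (suc k) f h with f fzero in f₀
  ... | true  = fzero , f₀
  ... | false = let (i , fi) = xorSum-true k (f ∘ fsuc) h in fsuc i , fi

  xorSum-⁅⁆ : ∀ {n} (b : Fin n → Bool) u → xorSum n (λ v → b v ∧ lookup ⁅ v ⁆ u) ≡ b u
  xorSum-⁅⁆ {suc n} b fzero = trans
    (cong₂ _xor_ (∧-identityʳ (b fzero))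
      (trans (⊕.sumᶠ-cong n (λ v → ∧-zeroʳ (b (fsuc v)))) (⊕.sumᶠ-zero n)))
    (xor-identityʳ (b fzero))
  xorSum-⁅⁆ {suc n} b (fsuc u) = cong₂ _xor_
    (trans (cong (b fzero ∧_) (lookup-replicate u false)) (∧-zeroʳ (b fzero)))
    (xorSum-⁅⁆ (b ∘ fsuc) u)

  ⊆⇒lookup : ∀ {n} {p q : Subset n} → p ⊆ q → ∀ i → lookup p i ≡ true → lookup q i ≡ true
  ⊆⇒lookup {p = p} p⊆q i pᵢ = []=⇒lookup (p⊆q (lookup⇒[]= i p pᵢ))

  lookup⇒⊆ : ∀ {n} {p q : Subset n} → (∀ i → lookup p i ≡ true → lookup q i ≡ true) → p ⊆ q
  lookup⇒⊆ {q = q} h {i} i∈p = lookup⇒[]= i q (h i ([]=⇒lookup i∈p))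

  ─-monoˡ-⊆ : ∀ {n} {p q : Subset n} (r : Subset n) → p ⊆ q → p ─ r ⊆ q ─ r
  ─-monoˡ-⊆ {p = p} {q} r p⊆q = lookup⇒⊆ λ i h →
    trans (lookup-─ q r i) (mono (lookup r i) (⊆⇒lookup p⊆q i) (trans (sym (lookup-─ p r i)) h))
    where
    mono : ∀ {a b} c → (a ≡ true → b ≡ true) → a ∧ not c ≡ true → b ∧ not c ≡ true
    mono {true} false a⇒b _ = cong (_∧ true) (a⇒b refl)

  ∪──⊆ : ∀ {n} {T S₂ : Subset n} (S₁ : Subset n) → T ⊆ S₂ → (T ∪ S₁) ─ (S₂ ─ S₁) ⊆ S₁
  ∪──⊆ {T = T} {S₂} S₁ T⊆S₂ = lookup⇒⊆ λ i h →
    inS₁ (lookup S₁ i) (⊆⇒lookup T⊆S₂ i)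
      (trans (sym (trans (lookup-─ (T ∪ S₁) (S₂ ─ S₁) i)
                         (cong₂ (λ a b → a ∧ not b) (lookup-∪ T S₁ i) (lookup-─ S₂ S₁ i)))) h)
    where
    inS₁ : ∀ {t s₂} s₁ → (t ≡ true → s₂ ≡ true) → (t ∨ s₁) ∧ not (s₂ ∧ not s₁) ≡ true → s₁ ≡ true
    inS₁ true  _ _ = refl
    inS₁ {true} false t⇒s₂ h with t⇒s₂ refl
    inS₁ {true} false t⇒s₂ () | refl

  parity-∪∩─ : ∀ {n} {T S₂ : Subset n} (S₁ : Subset n) → T ⊆ S₂ →
               parity ((T ∪ S₁) ∩ (S₂ ─ S₁)) ≡ parity (T ─ S₁)
  parity-∪∩─ {n} {T} {S₂} S₁ T⊆S₂ = ⊕.sumᶠ-cong n λ i → begin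
    lookup ((T ∪ S₁) ∩ (S₂ ─ S₁)) i
      ≡⟨ trans (lookup-∩ (T ∪ S₁) (S₂ ─ S₁) i) (cong₂ _∧_ (lookup-∪ T S₁ i) (lookup-─ S₂ S₁ i)) ⟩
    (lookup T i ∨ lookup S₁ i) ∧ (lookup S₂ i ∧ not (lookup S₁ i))
      ≡⟨ meet (lookup T i) (lookup S₁ i) (⊆⇒lookup T⊆S₂ i) ⟩
    lookup T i ∧ not (lookup S₁ i)
      ≡⟨ sym (lookup-─ T S₁ i) ⟩
    lookup (T ─ S₁) i ∎
    where
    open ≡.≡-Reasoning
    meet : ∀ t s₁ {s₂} → (t ≡ true → s₂ ≡ true) → (t ∨ s₁) ∧ (s₂ ∧ not s₁) ≡ t ∧ not s₁
    meet true  true  _    = ∧-zeroʳ _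
    meet true  false t⇒s₂ = trans (∧-identityʳ _) (t⇒s₂ refl)
    meet false true  _    = ∧-zeroʳ _
    meet false false _    = refl

-- Handshake modulo 2: a perfect matching meets every odd cut.
module MatchingCuts {c ℓ₁ ℓ₂} (F : OrderedField c ℓ₁ ℓ₂) (G : Graph) where
  open ≡ using (refl; sym; trans; cong; cong₂)
  open Graph G
  open Theory F G using (inδ; isEndpoint; PerfectMatching)
  open Parity

  -- edges are not loops, so "v is an endpoint of e" is an exclusive or
  isEndpoint≡xor : ∀ v e →
    isEndpoint v e ≡ lookup ⁅ v ⁆ (proj₁ (ends e)) xor lookup ⁅ v ⁆ (proj₂ (ends e))
  isEndpoint≡xor v e with lookup ⁅ v ⁆ (proj₁ (ends e)) in v≡u₁ | lookup ⁅ v ⁆ (proj₂ (ends e)) in v≡u₂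
  ... | true  | true  = ⊥-elim (loopless e (trans (at v≡u₁) (sym (at v≡u₂))))
    where
    at : ∀ {u} → lookup ⁅ v ⁆ u ≡ true → u ≡ v
    at {u} h = x∈⁅y⁆⇒x≡y v (lookup⇒[]= u ⁅ v ⁆ h)
  ... | true  | false = refl
  ... | false | true  = refl
  ... | false | false = refl

  xorSum-incident : ∀ (U : Subset n) e → xorSum n (λ v → lookup U v ∧ isEndpoint v e) ≡ inδ U e
  xorSum-incident U e = trans
    (⊕.sumᶠ-cong n (λ v → trans (cong (lookup U v ∧_) (isEndpoint≡xor v e))
                                (∧-distribˡ-xor (lookup U v) _ _)))
    (trans (⊕.sumᶠ-+ n _ _) (cong₂ _xor_ (xorSum-⁅⁆ (lookup U) _) (xorSum-⁅⁆ (lookup U) _)))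

  -- Every vertex has exactly one M-edge, so the parity of U equals the parity
  -- of the number of M-edges leaving U (double counting modulo 2).
  parity≡matching-cut : ∀ M → PerfectMatching M → ∀ (U : Subset n) →
                        parity U ≡ xorSum m (λ e → M e ∧ inδ U e)
  parity≡matching-cut M perfect U = begin
    xorSum n (lookup U)
      ≡⟨ ⊕.sumᶠ-cong n (λ v → trans (sym (∧-identityʳ (lookup U v))) (cong (lookup U v ∧_) (sym (degree v)))) ⟩
    xorSum n (λ v → lookup U v ∧ xorSum m (λ e → M e ∧ isEndpoint v e))
      ≡⟨ ⊕.sumᶠ-cong n (λ v → sym (⊕.sumᶠ-*ˡ m (lookup U v) _)) ⟩
    xorSum n (λ v → xorSum m (λ e → lookup U v ∧ (M e ∧ isEndpoint v e)))
      ≡⟨ ⊕.sumᶠ-comm n m _ ⟩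
    xorSum m (λ e → xorSum n (λ v → lookup U v ∧ (M e ∧ isEndpoint v e)))
      ≡⟨ ⊕.sumᶠ-cong m (λ e → trans (⊕.sumᶠ-cong n (λ v → ∧-left-comm (lookup U v) (M e) _))
                                    (⊕.sumᶠ-*ˡ n (M e) _)) ⟩
    xorSum m (λ e → M e ∧ xorSum n (λ v → lookup U v ∧ isEndpoint v e))
      ≡⟨ ⊕.sumᶠ-cong m (λ e → cong (M e ∧_) (xorSum-incident U e)) ⟩
    xorSum m (λ e → M e ∧ inδ U e) ∎
    where
    open ≡.≡-Reasoning
    degree : ∀ v → xorSum m (λ e → M e ∧ isEndpoint v e) ≡ true
    degree v = trans (sym (odd-countFin m _)) (cong odd (perfect v))
    ∧-left-comm : ∀ a b c → a ∧ (b ∧ c) ≡ b ∧ (a ∧ c)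
    ∧-left-comm a b c = trans (sym (∧-assoc a b c)) (trans (cong (_∧ c) (∧-comm a b)) (∧-assoc b a c))

  odd-cut-meets-matching : ∀ M → PerfectMatching M → ∀ (U : Subset n) → parity U ≡ true →
                           ∃[ e ] M e ∧ inδ U e ≡ true
  odd-cut-meets-matching M perfect U odd-U =
    xorSum-true m _ (trans (sym (parity≡matching-cut M perfect U)) odd-U)

module OrderedFieldFacts {c ℓ₁ ℓ₂} (F : OrderedField c ℓ₁ ℓ₂) where
  open OrderedField F
  module ≤ = IsTotalOrder isTotalOrder
  module Σ = FinSum commutativeSemiring
  open Σ using (sumᶠ) public

  ≤-resp-≈ : ∀ {a b a′ b′} → a ≈ a′ → b ≈ b′ → a ≤ b → a′ ≤ b′
  ≤-resp-≈ a≈a′ b≈b′ a≤b = ≤.≤-respˡ-≈ a≈a′ (≤.≤-respʳ-≈ b≈b′ a≤b)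

  +-monoʳ-≤ : ∀ {a b} d → a ≤ b → d + a ≤ d + b
  +-monoʳ-≤ {a} {b} d a≤b = ≤-resp-≈ (+-comm a d) (+-comm b d) (+-monoˡ-≤ d a≤b)

  +-mono-≤ : ∀ {a b c d} → a ≤ b → c ≤ d → a + c ≤ b + d
  +-mono-≤ {b = b} {c} a≤b c≤d = ≤.trans (+-monoˡ-≤ c a≤b) (+-monoʳ-≤ b c≤d)

  +-cancelʳ-≤ : ∀ {a b} d → a + d ≤ b + d → a ≤ b
  +-cancelʳ-≤ {a} {b} d h = ≤-resp-≈ (cancel a) (cancel b) (+-monoˡ-≤ (- d) h)
    where
    cancel : ∀ a → a + d + - d ≈ a
    cancel a = trans (+-assoc a d (- d)) (trans (+-congˡ (-‿inverseʳ d)) (+-identityʳ a))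

  +-cancelˡ-≤ : ∀ {a b} d → d + a ≤ d + b → a ≤ b
  +-cancelˡ-≤ {a} {b} d h = +-cancelʳ-≤ d (≤-resp-≈ (+-comm d a) (+-comm d b) h)

  x≤x+y : ∀ {a b} → 0# ≤ b → a ≤ a + b
  x≤x+y {a} 0≤b = ≤-resp-≈ (+-identityʳ a) refl (+-monoʳ-≤ a 0≤b)

  squeeze : ∀ {a a′ b b′} → a ≤ a′ → b ≤ b′ → a′ + b′ ≈ a + b → a ≈ a′ × b ≈ b′
  squeeze {a} {a′} {b} {b′} a≤a′ b≤b′ sum≈ =
    ≤.antisym a≤a′ (+-cancelʳ-≤ b′ (≤.trans (≤.reflexive sum≈) (+-monoʳ-≤ a b≤b′))) ,
    ≤.antisym b≤b′ (+-cancelˡ-≤ a′ (≤.trans (≤.reflexive sum≈) (+-monoˡ-≤ b a≤a′)))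

  ≥1-≥1-squeeze : ∀ {p q r} → 1# ≤ p → 1# ≤ q → 0# ≤ r → (p + q) + (r + r) ≈ 1# + 1# →
                  p ≈ 1# × q ≈ 1# × r ≈ 0#
  ≥1-≥1-squeeze {p} {q} {r} 1≤p 1≤q 0≤r total≈2 =
    sym (proj₁ tight-p) , sym (proj₁ tight-q) ,
    ≤.antisym (≤.trans (x≤x+y 0≤r) (≤.reflexive (sym (proj₂ tight-q)))) 0≤r
    where
    0≤2r : 0# ≤ r + r
    0≤2r = ≤.trans 0≤r (x≤x+y 0≤r)
    tight-p : 1# ≈ p × 1# ≈ q + (r + r)
    tight-p = squeeze 1≤p (≤.trans 1≤q (x≤x+y 0≤2r)) (trans (sym (+-assoc p q (r + r))) total≈2)
    tight-q : 1# ≈ q × 0# ≈ r + r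
    tight-q = squeeze 1≤q 0≤2r (trans (sym (proj₂ tight-p)) (sym (+-identityʳ 1#)))

  0≤1 : 0# ≤ 1#
  0≤1 with ≤.total 0# 1#
  ... | inj₁ 0≤1 = 0≤1
  ... | inj₂ 1≤0 = ≤-resp-≈ refl (-1*-1≈1) (*-nonneg 0≤-1 0≤-1)
    where
    module RP = RingProperties ring
    0≤-1 : 0# ≤ - 1#
    0≤-1 = ≤-resp-≈ (-‿inverseʳ 1#) (+-identityˡ (- 1#)) (+-monoˡ-≤ (- 1#) 1≤0)
    -1*-1≈1 : - 1# * - 1# ≈ 1#
    -1*-1≈1 = trans (RP.-1*x≈-x (- 1#)) (RP.-‿involutive 1#)

  ≤-*-≥1 : ∀ {a s} → 0# ≤ a → 1# ≤ s → a ≤ a * s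
  ≤-*-≥1 {a} {s} 0≤a 1≤s = ≤-resp-≈ (*-identityʳ a) a1+a[s-1]≈as (x≤x+y (*-nonneg 0≤a 0≤s-1))
    where
    0≤s-1 : 0# ≤ s + - 1#
    0≤s-1 = ≤-resp-≈ (-‿inverseʳ 1#) refl (+-monoˡ-≤ (- 1#) 1≤s)
    a1+a[s-1]≈as : a * 1# + a * (s + - 1#) ≈ a * s
    a1+a[s-1]≈as = trans (sym (distribˡ a 1# (s + - 1#))) (*-congˡ (trans (+-comm 1# (s + - 1#))
      (trans (+-assoc s (- 1#) 1#) (trans (+-congˡ (-‿inverseˡ 1#)) (+-identityʳ s)))))

  sumᶠ-mono : ∀ k {f g : Fin k → Carrier} → (∀ i → f i ≤ g i) → sumᶠ k f ≤ sumᶠ k g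
  sumᶠ-mono zero    f≤g = ≤.refl
  sumᶠ-mono (suc k) f≤g = +-mono-≤ (f≤g fzero) (sumᶠ-mono k (f≤g ∘ fsuc))

  sumᶠ-nonneg : ∀ k {f : Fin k → Carrier} → (∀ i → 0# ≤ f i) → 0# ≤ sumᶠ k f
  sumᶠ-nonneg k 0≤f = ≤-resp-≈ (Σ.sumᶠ-zero k) refl (sumᶠ-mono k 0≤f)

  term≤sumᶠ : ∀ k {f : Fin k → Carrier} → (∀ i → 0# ≤ f i) → ∀ i → f i ≤ sumᶠ k f
  term≤sumᶠ (suc k) 0≤f fzero    = x≤x+y (sumᶠ-nonneg k (0≤f ∘ fsuc))
  term≤sumᶠ (suc k) 0≤f (fsuc i) = ≤.trans (term≤sumᶠ k (0≤f ∘ fsuc) i)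
    (≤-resp-≈ (+-identityˡ _) refl (+-monoˡ-≤ _ (0≤f fzero)))

  sumᶠ≈0⇒terms≈0 : ∀ k {f : Fin k → Carrier} → (∀ i → 0# ≤ f i) → sumᶠ k f ≈ 0# → ∀ i → f i ≈ 0#
  sumᶠ≈0⇒terms≈0 k 0≤f Σf≈0 i = ≤.antisym (≤.trans (term≤sumᶠ k 0≤f i) (≤.reflexive Σf≈0)) (0≤f i)

module Spans {c ℓ₁ ℓ₂} (F : OrderedField c ℓ₁ ℓ₂) (G : Graph) where
  open OrderedField F
  open Graph G
  open Theory F G
  module Σ = FinSum commutativeSemiring
  open import Algebra.Properties.CommutativeSemigroup +-commutativeSemigroup
    using () renaming (interchange to +-interchange)

  record Subspace {a} (Q : Vect → Set a) : Set (c ⊔ ℓ₁ ⊔ a) where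
    field
      resp     : ∀ {u v} → (∀ e → u e ≈ v e) → Q u → Q v
      has-0    : Q (λ _ → 0#)
      closed-+ : ∀ {u v} → Q u → Q v → Q (λ e → u e + v e)
      closed-* : ∀ a {u} → Q u → Q (λ e → a * u e)

    exchange : ∀ {t s p q} → Q s → Q p → Q q → (∀ e → t e + s e ≈ p e + q e) → Q t
    exchange {t} {s} {p} {q} Qs Qp Qq t+s≈p+q =
      resp solve (closed-+ (closed-+ Qp Qq) (closed-* (- 1#) Qs))
      where
      open import Relation.Binary.Reasoning.Setoid setoid
      solve : ∀ e → (p e + q e) + - 1# * s e ≈ t e
      solve e = begin
        (p e + q e) + - 1# * s e ≈⟨ +-cong (sym (t+s≈p+q e)) (RingProperties.-1*x≈-x ring (s e)) ⟩
        (t e + s e) + - s e      ≈⟨ +-assoc (t e) (s e) (- s e) ⟩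
        t e + (s e + - s e)      ≈⟨ +-congˡ (-‿inverseʳ (s e)) ⟩
        t e + 0#                 ≈⟨ +-identityʳ (t e) ⟩
        t e                      ∎

  open Subspace

  private
    zipWith-++ : ∀ {a b d} {A : Set a} {B : Set b} {D : Set d} {k l} (h : A → B → D)
                 (u : Vector A k) (v : Vector A l) (u′ : Vector B k) (v′ : Vector B l) i →
                 h ((u ++ v) i) ((u′ ++ v′) i) ≡ ((λ j → h (u j) (u′ j)) ++ (λ j → h (v j) (v′ j))) i
    zipWith-++ {k = k} h u v u′ v′ i with splitAt k i
    ... | inj₁ j = ≡.refl
    ... | inj₂ j = ≡.refl

  Λ-subspace : ∀ x S → Subspace (Λ x S)
  Λ-subspace x S .resp u≈v (k , Ts , cs , gen , u≈) =
    k , Ts , cs , gen , λ e → trans (sym (u≈v e)) (u≈ e)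
  Λ-subspace x S .has-0 = 0 , (λ ()) , (λ ()) , (λ ()) , λ e → refl
  Λ-subspace x S .closed-+ (k , Ts , cs , gen , u≈) (l , Ts′ , cs′ , gen′ , v≈) =
    k ℕ.+ l , Ts ++ Ts′ , cs ++ cs′ , ++⁺ (λ T → T ⊆ S × TightOdd x T) gen gen′ , λ e →
      trans (+-cong (u≈ e) (v≈ e))
        (trans (sym (Σ.sumᶠ-++ k l _ _))
          (Σ.sumᶠ-cong (k ℕ.+ l) λ i →
            reflexive (≡.sym (zipWith-++ (λ c T → c * 𝟙 (inδ T) e) cs cs′ Ts Ts′ i))))
  Λ-subspace x S .closed-* a (k , Ts , cs , gen , v≈) =
    k , Ts , (λ i → a * cs i) , gen , λ e →
      trans (*-congˡ (v≈ e)) (trans (sym (Σ.sumᶠ-*ˡ k a _)) (Σ.sumᶠ-cong k λ i → sym (*-assoc a (cs i) _)))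

  Λ-generator : ∀ {x S T} → T ⊆ S → TightOdd x T → Λ x S (𝟙 (inδ T))
  Λ-generator {T = T} T⊆S tight-T =
    1 , (λ _ → T) , (λ _ → 1#) , (λ _ → T⊆S , tight-T) , λ e →
      sym (trans (+-identityʳ _) (*-identityˡ _))

  Λ-least : ∀ {a} {Q : Vect → Set a} {x S} → Subspace Q →
            (∀ T → T ⊆ S → TightOdd x T → Q (𝟙 (inδ T))) → Λ x S ⊑ Q
  Λ-least {Q = Q} {x} {S} Q-sub gens v (k , Ts , cs , gen , v≈) =
    resp Q-sub (λ e → sym (v≈ e)) (combination k Ts cs gen)
    where
    combination : ∀ k (Ts : Fin k → Subset n) (cs : Fin k → Carrier) →
                  (∀ i → Ts i ⊆ S × TightOdd x (Ts i)) → Q (λ e → Σ[ k ] (λ i → cs i * 𝟙 (inδ (Ts i)) e))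
    combination zero    Ts cs gen = has-0 Q-sub
    combination (suc k) Ts cs gen = closed-+ Q-sub
      (closed-* Q-sub (cs fzero) (gens (Ts fzero) (proj₁ (gen fzero)) (proj₂ (gen fzero))))
      (combination k (Ts ∘ fsuc) (cs ∘ fsuc) (gen ∘ fsuc))

  Λ-mono : ∀ {x S S′} → S ⊆ S′ → Λ x S ⊑ Λ x S′
  Λ-mono {x} {S} {S′} S⊆S′ = Λ-least (Λ-subspace x S′) (λ T T⊆S tight-T → Λ-generator (S⊆S′ ∘ T⊆S) tight-T)

  ⊕-subspace : ∀ {a b} {A : Vect → Set a} {B : Vect → Set b} → Subspace A → Subspace B → Subspace (A ⊕ B)
  ⊕-subspace A-sub B-sub .resp v≈v′ (u , w , Au , Bw , v≈) =
    u , w , Au , Bw , λ e → trans (sym (v≈v′ e)) (v≈ e)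
  ⊕-subspace A-sub B-sub .has-0 = _ , _ , has-0 A-sub , has-0 B-sub , λ e → sym (+-identityʳ 0#)
  ⊕-subspace A-sub B-sub .closed-+ (u , w , Au , Bw , v≈) (u′ , w′ , Au′ , Bw′ , v′≈) =
    _ , _ , closed-+ A-sub Au Au′ , closed-+ B-sub Bw Bw′ , λ e →
      trans (+-cong (v≈ e) (v′≈ e)) (+-interchange (u e) (w e) (u′ e) (w′ e))
  ⊕-subspace A-sub B-sub .closed-* a (u , w , Au , Bw , v≈) =
    _ , _ , closed-* A-sub a Au , closed-* B-sub a Bw , λ e → trans (*-congˡ (v≈ e)) (distribˡ a (u e) (w e))

  ⊕-inˡ : ∀ {a b} {A : Vect → Set a} {B : Vect → Set b} → Subspace B → A ⊑ (A ⊕ B)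
  ⊕-inˡ B-sub v Av = v , _ , Av , has-0 B-sub , λ e → sym (+-identityʳ (v e))

  ⊕-inʳ : ∀ {a b} {A : Vect → Set a} {B : Vect → Set b} → Subspace A → B ⊑ (A ⊕ B)
  ⊕-inʳ A-sub v Bv = _ , v , has-0 A-sub , Bv , λ e → sym (+-identityˡ (v e))

  ⊕-least : ∀ {a b q} {A : Vect → Set a} {B : Vect → Set b} {Q : Vect → Set q} →
            Subspace Q → A ⊑ Q → B ⊑ Q → (A ⊕ B) ⊑ Q
  ⊕-least Q-sub A⊑Q B⊑Q v (u , w , Au , Bw , v≈) =
    resp Q-sub (λ e → sym (v≈ e)) (closed-+ Q-sub (A⊑Q u Au) (B⊑Q w Bw))

  Λ-⊕-∪ : ∀ {x} S₁ S₂ → (Λ x S₁ ⊕ Λ x S₂) ⊑ Λ x (S₁ ∪ S₂)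
  Λ-⊕-∪ {x} S₁ S₂ = ⊕-least (Λ-subspace x (S₁ ∪ S₂)) (Λ-mono (p⊆p∪q S₂)) (Λ-mono (q⊆p∪q S₁ S₂))

module Uncrossing {c ℓ₁ ℓ₂} (F : OrderedField c ℓ₁ ℓ₂) (G : Graph) where
  open OrderedField F
  open Graph G
  open Theory F G
  open Parity
  open OrderedFieldFacts F
  open MatchingCuts F G using (odd-cut-meets-matching)
  open import Algebra.Properties.Monoid.Mult +-monoid using (×-homo-+; ×-congˡ) renaming (_×_ to _·_)

  -- y on a selected edge, 0 elsewhere: x⟨ x ⟩ M and 𝟙 M are sums/vectors of such terms
  keep : Bool → Carrier → Carrier
  keep b y = if b then y else 0#

  keep-nonneg : ∀ b {y} → 0# ≤ y → 0# ≤ keep b y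
  keep-nonneg true  0≤y = 0≤y
  keep-nonneg false _   = ≤.refl

  keep≈bit· : ∀ b y → keep b y ≈ bit b · y
  keep≈bit· true  y = sym (+-identityʳ y)
  keep≈bit· false y = refl

  -- An edge meets C and D as often as A and B, up to an even excess 2X.
  record Crossing (a b c d : Bool) : Set where
    constructor excess-by
    field
      X     : Bool
      count : bit a ℕ.+ bit b ≡ (bit c ℕ.+ bit d) ℕ.+ (bit X ℕ.+ bit X)

  keep-crossing : ∀ {a b c d} (crossing : Crossing a b c d) y → let X = Crossing.X crossing in
                  keep a y + keep b y ≈ (keep c y + keep d y) + (keep X y + keep X y)
  keep-crossing {a} {b} {c} {d} (excess-by X count) y = begin
    keep a y + keep b y                            ≈⟨ +-cong (keep≈bit· a y) (keep≈bit· b y) ⟩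
    bit a · y + bit b · y                          ≈⟨ ×-homo-+ y (bit a) (bit b) ⟨
    (bit a ℕ.+ bit b) · y                          ≈⟨ ×-congˡ count ⟩
    ((bit c ℕ.+ bit d) ℕ.+ (bit X ℕ.+ bit X)) · y  ≈⟨ ×-homo-+ y (bit c ℕ.+ bit d) (bit X ℕ.+ bit X) ⟩
    (bit c ℕ.+ bit d) · y + (bit X ℕ.+ bit X) · y  ≈⟨ +-cong (×-homo-+ y (bit c) (bit d)) (×-homo-+ y (bit X) (bit X)) ⟩
    (bit c · y + bit d · y) + (bit X · y + bit X · y)
      ≈⟨ +-cong (+-cong (keep≈bit· c y) (keep≈bit· d y)) (+-cong (keep≈bit· X y) (keep≈bit· X y)) ⟨
    (keep c y + keep d y) + (keep X y + keep X y)  ∎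
    where open import Relation.Binary.Reasoning.Setoid setoid

  -- The odd-cut inequality: x(δ(U)) ≥ 1 for every odd U and x ∈ PM(G), since
  -- every perfect matching has an edge in δ(U).
  odd-cut-≥1 : ∀ {x} → InPM x → ∀ (U : Subset n) → parity U ≡ true → 1# ≤ x⟨ x ⟩ (inδ U)
  odd-cut-≥1 {x} (k , Ms , λs , perfect , 0≤λ , Σλ≈1 , x≈) U odd-U =
    ≤-resp-≈ Σλ≈1 (sym split) (sumᶠ-mono k (λ i → ≤-*-≥1 (0≤λ i) (matching-cut≥1 i)))
    where
    matching-cut : Fin k → Carrier
    matching-cut i = Σ[ m ] (λ e → keep (inδ U e) (𝟙 (Ms i) e))
    matching-cut≥1 : ∀ i → 1# ≤ matching-cut i
    matching-cut≥1 i with odd-cut-meets-matching (Ms i) (perfect i) U odd-U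
    ... | e , e∈Mᵢ∩δU = ≤.trans (one (Ms i e) (inδ U e) e∈Mᵢ∩δU)
      (term≤sumᶠ m (λ e → keep-nonneg (inδ U e) (keep-nonneg (Ms i e) 0≤1)) e)
      where
      one : ∀ a b → a ∧ b ≡ true → 1# ≤ keep b (keep a 1#)
      one true true _ = ≤.refl
    pointwise : ∀ e → keep (inδ U e) (x e) ≈ Σ[ k ] (λ i → λs i * keep (inδ U e) (𝟙 (Ms i) e))
    pointwise e with inδ U e
    ... | true  = x≈ e
    ... | false = sym (trans (Σ.sumᶠ-cong k (λ i → zeroʳ (λs i))) (Σ.sumᶠ-zero k))
    split : x⟨ x ⟩ (inδ U) ≈ Σ[ k ] (λ i → λs i * matching-cut i)
    split = trans (Σ.sumᶠ-cong m pointwise)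
      (trans (Σ.sumᶠ-comm m k _) (Σ.sumᶠ-cong k (λ i → Σ.sumᶠ-*ˡ m (λs i) _)))

  excess : ∀ {a b c d : Fin m → Bool} → (∀ e → Crossing (a e) (b e) (c e) (d e)) → Fin m → Bool
  excess crossing e = Crossing.X (crossing e)

  crossing-weights : ∀ {a b c d : Fin m → Bool} (crossing : ∀ e → Crossing (a e) (b e) (c e) (d e)) x →
    x⟨ x ⟩ a + x⟨ x ⟩ b ≈ (x⟨ x ⟩ c + x⟨ x ⟩ d) + (x⟨ x ⟩ (excess crossing) + x⟨ x ⟩ (excess crossing))
  crossing-weights {a} {b} {c} {d} crossing x = begin
    x⟨ x ⟩ a + x⟨ x ⟩ b
      ≈⟨ Σ.sumᶠ-+ m _ _ ⟨
    Σ[ m ] (λ e → keep (a e) (x e) + keep (b e) (x e))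
      ≈⟨ Σ.sumᶠ-cong m (λ e → keep-crossing (crossing e) (x e)) ⟩
    Σ[ m ] (λ e → (keep (c e) (x e) + keep (d e) (x e)) + (keep (X e) (x e) + keep (X e) (x e)))
      ≈⟨ Σ.sumᶠ-+ m _ _ ⟩
    Σ[ m ] (λ e → keep (c e) (x e) + keep (d e) (x e)) + Σ[ m ] (λ e → keep (X e) (x e) + keep (X e) (x e))
      ≈⟨ +-cong (Σ.sumᶠ-+ m _ _) (Σ.sumᶠ-+ m _ _) ⟩
    (x⟨ x ⟩ c + x⟨ x ⟩ d) + (x⟨ x ⟩ X + x⟨ x ⟩ X) ∎
    where
    open import Relation.Binary.Reasoning.Setoid setoid
    X : Fin m → Bool
    X = excess crossing

  positive-support : ∀ {x} → (∀ e → 0# < x e) → ∀ M → x⟨ x ⟩ M ≈ 0# → ∀ e → M e ≡ false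
  positive-support {x} x>0 M xM≈0 e =
    empty (M e) (sumᶠ≈0⇒terms≈0 m (λ e → keep-nonneg (M e) (proj₁ (x>0 e))) xM≈0 e)
    where
    empty : ∀ b → keep b (x e) ≈ 0# → b ≡ false
    empty true  xₑ≈0 = ⊥-elim (proj₂ (x>0 e) (sym xₑ≈0))
    empty false _    = ≡.refl

  -- Then x(δC) + x(δD) + 2 x(excess) = 2 with
  -- x(δC), x(δD) ≥ 1, so C and D are tight and, x being positive, there are no
  -- excess edges: 𝟙δA + 𝟙δB = 𝟙δC + 𝟙δD.
  uncross : ∀ {x} → InPM x → (∀ e → 0# < x e) → ∀ A B C D →
    TightOdd x A → TightOdd x B → parity C ≡ true → parity D ≡ true →
    (∀ e → Crossing (inδ A e) (inδ B e) (inδ C e) (inδ D e)) →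
    TightOdd x C × TightOdd x D × (∀ e → 𝟙 (inδ A) e + 𝟙 (inδ B) e ≈ 𝟙 (inδ C) e + 𝟙 (inδ D) e)
  uncross {x} x∈PM x>0 A B C D (_ , tight-A) (_ , tight-B) odd-C odd-D crossing =
    (parity⇒odd C odd-C , proj₁ tightness) , (parity⇒odd D odd-D , proj₁ (proj₂ tightness)) , cut-vectors
    where
    X : Fin m → Bool
    X = excess crossing
    budget : (x⟨ x ⟩ (inδ C) + x⟨ x ⟩ (inδ D)) + (x⟨ x ⟩ X + x⟨ x ⟩ X) ≈ 1# + 1#
    budget = trans (sym (crossing-weights crossing x)) (+-cong tight-A tight-B)
    tightness : x⟨ x ⟩ (inδ C) ≈ 1# × x⟨ x ⟩ (inδ D) ≈ 1# × x⟨ x ⟩ X ≈ 0#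
    tightness = ≥1-≥1-squeeze (odd-cut-≥1 x∈PM C odd-C) (odd-cut-≥1 x∈PM D odd-D)
                  (sumᶠ-nonneg m (λ e → keep-nonneg (X e) (proj₁ (x>0 e)))) budget
    no-excess : ∀ e → X e ≡ false
    no-excess = positive-support x>0 X (proj₂ (proj₂ tightness))
    cut-vectors : ∀ e → 𝟙 (inδ A) e + 𝟙 (inδ B) e ≈ 𝟙 (inδ C) e + 𝟙 (inδ D) e
    cut-vectors e = trans (keep-crossing (crossing e) 1#)
      (trans (+-congˡ (reflexive (≡.cong (λ b → keep b 1# + keep b 1#) (no-excess e))))
             (trans (+-congˡ (+-identityʳ 0#)) (+-identityʳ _)))

  -- Edge-by-edge uncrossing identities, in terms of the memberships a₁, b₁ and
  -- a₂, b₂ of the two endpoints in A and B.  For A ∩ B, A ∪ B the excess edges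
  -- join A ─ B to B ─ A; for A ─ B, B ─ A they join A ∩ B to the outside of A ∪ B.
  crossing-∩∪ : ∀ a₁ b₁ a₂ b₂ →
    Crossing (a₁ xor a₂) (b₁ xor b₂) ((a₁ ∧ b₁) xor (a₂ ∧ b₂)) ((a₁ ∨ b₁) xor (a₂ ∨ b₂))
  crossing-∩∪ false false false false = excess-by false ≡.refl
  crossing-∩∪ false false false true  = excess-by false ≡.refl
  crossing-∩∪ false false true  false = excess-by false ≡.refl
  crossing-∩∪ false false true  true  = excess-by false ≡.refl
  crossing-∩∪ false true  false false = excess-by false ≡.refl
  crossing-∩∪ false true  false true  = excess-by false ≡.refl
  crossing-∩∪ false true  true  false = excess-by true  ≡.refl
  crossing-∩∪ false true  true  true  = excess-by false ≡.refl
  crossing-∩∪ true  false false false = excess-by false ≡.refl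
  crossing-∩∪ true  false false true  = excess-by true  ≡.refl
  crossing-∩∪ true  false true  false = excess-by false ≡.refl
  crossing-∩∪ true  false true  true  = excess-by false ≡.refl
  crossing-∩∪ true  true  false false = excess-by false ≡.refl
  crossing-∩∪ true  true  false true  = excess-by false ≡.refl
  crossing-∩∪ true  true  true  false = excess-by false ≡.refl
  crossing-∩∪ true  true  true  true  = excess-by false ≡.refl

  crossing-─ : ∀ a₁ b₁ a₂ b₂ →
    Crossing (a₁ xor a₂) (b₁ xor b₂) ((a₁ ∧ not b₁) xor (a₂ ∧ not b₂)) ((b₁ ∧ not a₁) xor (b₂ ∧ not a₂))
  crossing-─ false false false false = excess-by false ≡.refl
  crossing-─ false false false true  = excess-by false ≡.refl
  crossing-─ false false true  false = excess-by false ≡.refl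
  crossing-─ false false true  true  = excess-by true  ≡.refl
  crossing-─ false true  false false = excess-by false ≡.refl
  crossing-─ false true  false true  = excess-by false ≡.refl
  crossing-─ false true  true  false = excess-by false ≡.refl
  crossing-─ false true  true  true  = excess-by false ≡.refl
  crossing-─ true  false false false = excess-by false ≡.refl
  crossing-─ true  false false true  = excess-by false ≡.refl
  crossing-─ true  false true  false = excess-by false ≡.refl
  crossing-─ true  false true  true  = excess-by false ≡.refl
  crossing-─ true  true  false false = excess-by true  ≡.refl
  crossing-─ true  true  false true  = excess-by false ≡.refl
  crossing-─ true  true  true  false = excess-by false ≡.refl
  crossing-─ true  true  true  true  = excess-by false ≡.refl

  crossing-edge-∩∪ : ∀ (A B : Subset n) e → Crossing (inδ A e) (inδ B e) (inδ (A ∩ B) e) (inδ (A ∪ B) e)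
  crossing-edge-∩∪ A B e = ≡.subst₂ (Crossing (inδ A e) (inδ B e))
    (≡.sym (≡.cong₂ _xor_ (lookup-∩ A B u₁) (lookup-∩ A B u₂)))
    (≡.sym (≡.cong₂ _xor_ (lookup-∪ A B u₁) (lookup-∪ A B u₂)))
    (crossing-∩∪ (lookup A u₁) (lookup B u₁) (lookup A u₂) (lookup B u₂))
    where
    u₁ u₂ : Fin n
    u₁ = proj₁ (ends e)
    u₂ = proj₂ (ends e)

  crossing-edge-─ : ∀ (A B : Subset n) e → Crossing (inδ A e) (inδ B e) (inδ (A ─ B) e) (inδ (B ─ A) e)
  crossing-edge-─ A B e = ≡.subst₂ (Crossing (inδ A e) (inδ B e))
    (≡.sym (≡.cong₂ _xor_ (lookup-─ A B u₁) (lookup-─ A B u₂)))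
    (≡.sym (≡.cong₂ _xor_ (lookup-─ B A u₁) (lookup-─ B A u₂)))
    (crossing-─ (lookup A u₁) (lookup B u₁) (lookup A u₂) (lookup B u₂))
    where
    u₁ u₂ : Fin n
    u₁ = proj₁ (ends e)
    u₂ = proj₂ (ends e)

  module _ {x : Vect} (x∈PM : InPM x) (x>0 : ∀ e → 0# < x e) (A B : Subset n)
           (tight-A : TightOdd x A) (tight-B : TightOdd x B) where
    private
      odd-A : parity A ≡ true
      odd-A = odd⇒parity A (proj₁ tight-A)
      odd-B : parity B ≡ true
      odd-B = odd⇒parity B (proj₁ tight-B)

    uncross-∩∪ : parity (A ∩ B) ≡ true →
      TightOdd x (A ∩ B) × TightOdd x (A ∪ B) ×
      (∀ e → 𝟙 (inδ A) e + 𝟙 (inδ B) e ≈ 𝟙 (inδ (A ∩ B)) e + 𝟙 (inδ (A ∪ B)) e)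
    uncross-∩∪ odd-A∩B = uncross x∈PM x>0 A B (A ∩ B) (A ∪ B) tight-A tight-B odd-A∩B
      (≡.trans (odd-∪ A B odd-A odd-B) odd-A∩B) (crossing-edge-∩∪ A B)

    uncross-─ : parity (A ∩ B) ≡ false →
      TightOdd x (A ─ B) × TightOdd x (B ─ A) ×
      (∀ e → 𝟙 (inδ A) e + 𝟙 (inδ B) e ≈ 𝟙 (inδ (A ─ B)) e + 𝟙 (inδ (B ─ A)) e)
    uncross-─ even-A∩B = uncross x∈PM x>0 A B (A ─ B) (B ─ A) tight-A tight-B
      (≡.trans (odd-─ A B odd-A) (≡.cong not even-A∩B))
      (≡.trans (odd-─′ A B odd-B) (≡.cong not even-A∩B)) (crossing-edge-─ A B)

module Decomposition {c ℓ₁ ℓ₂} (F : OrderedField c ℓ₁ ℓ₂) (G : Graph) where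
  open OrderedField F
  open Graph G
  open Theory F G
  open Parity
  open Spans F G
  open Uncrossing F G

  module _ {x : Vect} (x∈PM : InPM x) (x>0 : ∀ e → 0# < x e) {S₁ S₂ : Subset n}
           (tight-S₁ : TightOdd x S₁) (tight-D : TightOdd x (S₂ ─ S₁)) where
    private
      D : Subset n
      D = S₂ ─ S₁
      Q : Vect → Set (c ⊔ ℓ₁)
      Q = Λ x S₁ ⊕ Λ x D

      Q-sub : Subspace Q
      Q-sub = ⊕-subspace (Λ-subspace x S₁) (Λ-subspace x D)

      in-S₁ : ∀ {T} → T ⊆ S₁ → TightOdd x T → Q (𝟙 (inδ T))
      in-S₁ T⊆S₁ tight-T = ⊕-inˡ (Λ-subspace x D) _ (Λ-generator T⊆S₁ tight-T)

      in-D : ∀ {T} → T ⊆ D → TightOdd x T → Q (𝟙 (inδ T))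
      in-D T⊆D tight-T = ⊕-inʳ (Λ-subspace x S₁) _ (Λ-generator T⊆D tight-T)

    -- Uncross T
    -- with S₁: for T ∩ S₁ even, 𝟙δT + 𝟙δS₁ = 𝟙δ(T ─ S₁) + 𝟙δ(S₁ ─ T); for T ∩ S₁ odd,
    -- 𝟙δT + 𝟙δS₁ = 𝟙δ(T ∩ S₁) + 𝟙δ(T ∪ S₁), and T ∪ S₁ is uncrossed once more with D.
    cut-vector-split : ∀ T → T ⊆ S₂ → TightOdd x T → Q (𝟙 (inδ T))
    cut-vector-split T T⊆S₂ tight-T with parity (T ∩ S₁) in T∩S₁-parity
    ... | false =
      let (tight-T─S₁ , tight-S₁─T , cuts) = uncross-─ x∈PM x>0 T S₁ tight-T tight-S₁ T∩S₁-parity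
      in Subspace.exchange Q-sub (in-S₁ ⊆-refl tight-S₁)
           (in-D (─-monoˡ-⊆ S₁ T⊆S₂) tight-T─S₁) (in-S₁ (p─q⊆p S₁ T) tight-S₁─T) cuts
    ... | true =
      let (tight-T∩S₁ , tight-T∪S₁ , cuts) = uncross-∩∪ x∈PM x>0 T S₁ tight-T tight-S₁ T∩S₁-parity
          even : parity ((T ∪ S₁) ∩ D) ≡ false
          even = ≡.trans (parity-∪∩─ S₁ T⊆S₂)
                   (≡.trans (odd-─ T S₁ (odd⇒parity T (proj₁ tight-T))) (≡.cong not T∩S₁-parity))
          (tight-T∪S₁─D , tight-D─T∪S₁ , cuts′) = uncross-─ x∈PM x>0 (T ∪ S₁) D tight-T∪S₁ tight-D even
          T∪S₁∈Q : Q (𝟙 (inδ (T ∪ S₁)))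
          T∪S₁∈Q = Subspace.exchange Q-sub (in-D ⊆-refl tight-D)
                     (in-S₁ (∪──⊆ S₁ T⊆S₂) tight-T∪S₁─D) (in-D (p─q⊆p D (T ∪ S₁)) tight-D─T∪S₁) cuts′
      in Subspace.exchange Q-sub (in-S₁ ⊆-refl tight-S₁) (in-S₁ (p∩q⊆q T S₁) tight-T∩S₁) T∪S₁∈Q cuts

    ⊕-reduce : (Λ x S₁ ⊕ Λ x S₂) ⊑ Q
    ⊕-reduce = ⊕-least Q-sub (⊕-inˡ (Λ-subspace x D)) (Λ-least Q-sub cut-vector-split)

lemma5p8 : ∀ {c ℓ₁ ℓ₂ : Level} (F : OrderedField c ℓ₁ ℓ₂) (G : Graph) →
    let open OrderedField F
        open Graph G
        open Theory F G
    in (x : Fin m → Carrier) → InPM x → (∀ e → 0# < x e) →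
       (S₁ S₂ : Subset n) → TightOdd x S₁ → TightOdd x S₂ →
       let case1 = TightOdd x (S₁ ∪ S₂) × ((Λ x S₁ ⊕ Λ x S₂) ⊑ Λ x (S₁ ∪ S₂))
           case2 = TightOdd x S₁ × TightOdd x (S₂ ─ S₁) ×
                   ((Λ x S₁ ⊕ Λ x S₂) ⊑ (Λ x S₁ ⊕ Λ x (S₂ ─ S₁)))
       in (case1 ⊎ case2) × ¬ (case1 × case2)
lemma5p8 {c} {ℓ₁} F G x x∈PM x>0 S₁ S₂ tight-S₁ tight-S₂ = case-on (parity (S₁ ∩ S₂)) ≡.refl , not-both
  where
  open Theory F G
  open Parity
  open Spans F G using (Λ-⊕-∪)
  open Uncrossing F G using (uncross-∩∪; uncross-─)
  open Decomposition F G using (⊕-reduce)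

  Case₁ Case₂ : Set (c ⊔ ℓ₁)
  Case₁ = TightOdd x (S₁ ∪ S₂) × ((Λ x S₁ ⊕ Λ x S₂) ⊑ Λ x (S₁ ∪ S₂))
  Case₂ = TightOdd x S₁ × TightOdd x (S₂ ─ S₁) × ((Λ x S₁ ⊕ Λ x S₂) ⊑ (Λ x S₁ ⊕ Λ x (S₂ ─ S₁)))

  -- which case holds is decided by the parity of S₁ ∩ S₂
  case-on : ∀ b → parity (S₁ ∩ S₂) ≡ b → Case₁ ⊎ Case₂
  case-on true  odd-∩  = inj₁ (proj₁ (proj₂ (uncross-∩∪ x∈PM x>0 S₁ S₂ tight-S₁ tight-S₂ odd-∩)) ,
                              Λ-⊕-∪ S₁ S₂)
  case-on false even-∩ = inj₂ (tight-S₁ , tight-S₂─S₁ , ⊕-reduce x∈PM x>0 tight-S₁ tight-S₂─S₁)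
    where
    tight-S₂─S₁ : TightOdd x (S₂ ─ S₁)
    tight-S₂─S₁ = proj₁ (proj₂ (uncross-─ x∈PM x>0 S₁ S₂ tight-S₁ tight-S₂ even-∩))

  -- S₁ ∪ S₂ and S₂ ─ S₁ cannot both be odd
  not-both : ¬ (Case₁ × Case₂)
  not-both ((tight-∪ , _) , (_ , tight-S₂─S₁ , _)) =
    ∪-─-not-both-odd S₁ S₂ (odd⇒parity S₁ (proj₁ tight-S₁)) (odd⇒parity S₂ (proj₁ tight-S₂))
      (odd⇒parity (S₁ ∪ S₂) (proj₁ tight-∪)) (odd⇒parity (S₂ ─ S₁) (proj₁ tight-S₂─S₁))
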